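{- Let $(\mathcal{U},\mathcal{S})$ be a set system, $|\mathcal{U}|\le n$, with set costs $c_s\in(1/C,1)$ for some $C>1$, and let $\epsilon\in(0,0.1)$, $L=\lceil\log_{1+\epsilon}(Cn)\rceil+1$. Suppose each set $s$ has a level $l(s)\in\{0,\dots,L\}$, each element $e$ has level $l(e)=\max_{s\ni e}l(s)$ and weight $w(e)=(1+\epsilon)^{ -l(e)}$, and for integer $i\ge0$, $w(s,i)=\sum_{e\in s}(1+\epsilon)^{ -\max\{i,\max_{s'\ne s:e\in s'}l(s')\}}$. Assume $w(s,l(s)+1)<c_s$ for every set $s$. Define the base level $b(s)=\lfloor\log_{1+\epsilon}(1/c_s)\rfloor$. Then for every set $s$ and every integer $i<b(s)$, no element of $s$ has level $i$, i.e. $\{e\in s: l(e)=i\}=\emptyset$.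
   Formalization: The set costs $c_s$ and the parameters $C$ and $\epsilon$ are rational. -}

module Defs where

open import Data.Bool using (Bool; true; false; if_then_else_)
open import Data.Nat as ℕ using (ℕ; zero; suc)
open import Data.Fin using (Fin; _≟_)
open import Data.Fin.Subset using (Subset)
open import Data.List using (List; map; filter; foldr; allFin)
open import Data.Vec using (lookup)
open import Data.Rational using (ℚ; 0ℚ; 1ℚ; _+_; _*_; _<_; _≤_; 1/_; positive)
open import Data.Rational.Properties using (pos⇒nonZero; <-trans)
open import Relation.Nullary using (does; ¬_)
open import Relation.Binary.PropositionalEquality using (_≡_)
open import Data.Product using (_×_)
import Data.Empty
import Relation.Nullary.Decidable
import Data.Bool

pow : ℚ → ℕ → ℚ
pow x zero    = 1ℚ
pow x (suc j) = x * pow x j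

recip : (x : ℚ) → 0ℚ < x → ℚ
recip x hx = 1/_ x {{pos⇒nonZero x {{positive hx}}}}

0<1 : 0ℚ < 1ℚ
0<1 = Data.Rational.Properties.positive⁻¹ 1ℚ

negPow : (ε : ℚ) → 0ℚ < ε → ℕ → ℚ
negPow ε hε j = pow (recip (1ℚ + ε) h) j
  where
  h : 0ℚ < 1ℚ + ε
  h = Data.Rational.Properties.+-mono-< {0ℚ} {1ℚ} {0ℚ} {ε} 0<1 hε

memb : {m k : ℕ} → (Fin k → Subset m) → Fin k → Fin m → Bool
memb S s e = lookup (S s) e

maxL : List ℕ → ℕ
maxL = foldr ℕ._⊔_ 0

elemLevel : {m k : ℕ} → (Fin k → Subset m) → (Fin k → ℕ) → Fin m → ℕ
elemLevel {m} {k} S l e = maxL (map l (filter (λ s → memb S s e ≟b true) (allFin k)))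
  where
  _≟b_ : (a b : Bool) → Relation.Nullary.Dec (a ≡ b)
  _≟b_ = Data.Bool._≟_

-- max_{s' ≠ s, e ∈ s'} l(s')   (0 if there is no such s')
otherLevel : {m k : ℕ} → (Fin k → Subset m) → (Fin k → ℕ) → Fin k → Fin m → ℕ
otherLevel {m} {k} S l s e =
  maxL (map l (filter (λ s' → Relation.Nullary.Decidable.¬? (s' ≟ s)
                               Relation.Nullary.Decidable.×-dec
                               Data.Bool._≟_ (memb S s' e) true) (allFin k)))

sumℚ : List ℚ → ℚ
sumℚ = foldr _+_ 0ℚ

wLevel : {m k : ℕ} → (ε : ℚ) → 0ℚ < ε → (Fin k → Subset m) → (Fin k → ℕ)
       → Fin k → ℕ → ℚ
wLevel {m} ε hε S l s i =
  sumℚ (map (λ e → if memb S s e then negPow ε hε (i ℕ.⊔ otherLevel S l s e) else 0ℚ)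
            (allFin m))

-- b = ⌊log_{1+ε} y⌋ for y > 1 (so b ≥ 0): (1+ε)^b ≤ y < (1+ε)^{b+1}
IsFloorLog : ℚ → ℚ → ℕ → Set
IsFloorLog ε y b = pow (1ℚ + ε) b ≤ y × y < pow (1ℚ + ε) (suc b)

-- t = ⌈log_{1+ε} y⌉ with t ≥ 1 : (1+ε)^{t-1} < y ≤ (1+ε)^t
IsCeilLog : ℚ → ℚ → ℕ → Set
IsCeilLog ε y zero    = Data.Empty.⊥
IsCeilLog ε y (suc t) = pow (1ℚ + ε) t < y × y ≤ pow (1ℚ + ε) (suc t)

-- Suppose an element e of s had level j < b(s). Then l(s) ≤ j, and every other set
-- containing e has level ≤ j, so the summand of e in w(s, l(s)+1) has exponent at most
-- b(s) and is at least (1+ε)^(-b(s)) ≥ c_s, because (1+ε)^b(s) ≤ 1/c_s. Since all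
-- summands are nonnegative, w(s, l(s)+1) ≥ c_s, contradicting the hypothesis.
module Submission where

open import Defs
open import Data.Nat as ℕ using (ℕ; suc)
open import Data.Integer as ℤ using (ℤ; +_)
open import Data.Fin using (Fin)
open import Data.Fin.Subset using (Subset; _∈_)
open import Data.Rational using (ℚ; 0ℚ; 1ℚ; _+_; _*_; _<_; _≤_; _/_)
open import Relation.Binary.PropositionalEquality using (_≢_)
open import Data.Product using (_×_)
import Data.Rational.Properties

open import Algebra.Bundles using (CommutativeMonoid)
open import Data.Bool using (true; false; if_then_else_)
open import Data.List using (List; []; _∷_; map; filter; allFin)
open import Data.List.Membership.Propositional using () renaming (_∈_ to _∈ₗ_)
open import Data.List.Membership.Propositional.Properties
  using (∈-map⁺; ∈-map⁻; ∈-filter⁺; ∈-filter⁻; ∈-allFin)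
open import Data.List.Relation.Unary.Any using (here; there)
open import Data.Product using (_,_)
open import Data.Rational using (nonNegative; positive)
open import Data.Rational.Properties
  using ( ≤-refl; ≤-trans; <⇒≤; ≤-<-trans; <-irrefl; +-mono-≤; +-mono-<; +-identityˡ; +-identityʳ
        ; *-identityˡ; *-identityʳ; *-monoˡ-≤-nonNeg; *-monoʳ-≤-nonNeg; *-inverseˡ; *-inverseʳ
        ; pos⇒nonZero; 1/pos⇒pos; positive⁻¹; nonNegative⁻¹; nonNeg*nonNeg⇒nonNeg
        ; *-1-commutativeMonoid; module ≤-Reasoning)
open import Data.Vec.Properties using ([]=⇒lookup)
import Data.Nat.Properties as ℕ
import Data.Fin.Properties as Fin
import Data.Bool.Properties as Bool
open import Relation.Binary.PropositionalEquality using (_≡_; refl; sym; trans; cong; cong₂; subst)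
open import Relation.Nullary.Decidable using (¬?; _×-dec_)

open import Algebra.Properties.CommutativeSemigroup
  (CommutativeMonoid.commutativeSemigroup *-1-commutativeMonoid) using (x∙yz≈y∙xz; interchange)

∈⇒≤maxL : ∀ {y} (ys : List ℕ) → y ∈ₗ ys → y ℕ.≤ maxL ys
∈⇒≤maxL (z ∷ zs) (here refl) = ℕ.m≤m⊔n z (maxL zs)
∈⇒≤maxL (z ∷ zs) (there y∈zs) = ℕ.≤-trans (∈⇒≤maxL zs y∈zs) (ℕ.m≤n⊔m z (maxL zs))

maxL-lub : ∀ {M} (ys : List ℕ) → (∀ {y} → y ∈ₗ ys → y ℕ.≤ M) → maxL ys ℕ.≤ M
maxL-lub []       _     = ℕ.z≤n
maxL-lub (z ∷ zs) ys≤M = ℕ.⊔-lub (ys≤M (here refl)) (maxL-lub zs (λ y∈zs → ys≤M (there y∈zs)))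

sumℚ-nonNeg : ∀ {A : Set} (f : A → ℚ) → (∀ x → 0ℚ ≤ f x) → ∀ xs → 0ℚ ≤ sumℚ (map f xs)
sumℚ-nonNeg f f≥0 []       = ≤-refl
sumℚ-nonNeg f f≥0 (x ∷ xs) =
  subst (_≤ f x + sumℚ (map f xs)) (+-identityʳ 0ℚ) (+-mono-≤ (f≥0 x) (sumℚ-nonNeg f f≥0 xs))

∈⇒≤sumℚ : ∀ {A : Set} (f : A → ℚ) → (∀ x → 0ℚ ≤ f x) →
          ∀ {x} xs → x ∈ₗ xs → f x ≤ sumℚ (map f xs)
∈⇒≤sumℚ f f≥0 (x ∷ xs) (here refl) =
  subst (_≤ f x + sumℚ (map f xs)) (+-identityʳ (f x)) (+-mono-≤ (≤-refl {f x}) (sumℚ-nonNeg f f≥0 xs))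
∈⇒≤sumℚ f f≥0 {y} (x ∷ xs) (there y∈xs) =
  subst (_≤ f x + sumℚ (map f xs)) (+-identityˡ (f y)) (+-mono-≤ (f≥0 x) (∈⇒≤sumℚ f f≥0 xs y∈xs))

pow-nonNeg : ∀ {r} → 0ℚ ≤ r → ∀ j → 0ℚ ≤ pow r j
pow-nonNeg r≥0 ℕ.zero    = <⇒≤ 0<1
pow-nonNeg {r} r≥0 (suc j) = nonNegative⁻¹ (r * pow r j)
  {{nonNeg*nonNeg⇒nonNeg r {{nonNegative r≥0}} (pow r j) {{nonNegative (pow-nonNeg r≥0 j)}}}}

pow-antimonoʳ-≤ : ∀ {r} → 0ℚ ≤ r → r ≤ 1ℚ → ∀ {i j} → i ℕ.≤ j → pow r j ≤ pow r i
pow-antimonoʳ-≤ r≥0 r≤1 {ℕ.zero} {ℕ.zero} _ = ≤-refl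
pow-antimonoʳ-≤ {r} r≥0 r≤1 {ℕ.zero} {suc j} _ = begin
  r * pow r j   ≤⟨ *-monoʳ-≤-nonNeg (pow r j) {{nonNegative (pow-nonNeg r≥0 j)}} r≤1 ⟩
  1ℚ * pow r j  ≡⟨ *-identityˡ (pow r j) ⟩
  pow r j       ≤⟨ pow-antimonoʳ-≤ r≥0 r≤1 {ℕ.zero} {j} ℕ.z≤n ⟩
  1ℚ            ∎
  where open ≤-Reasoning
pow-antimonoʳ-≤ {r} r≥0 r≤1 {suc i} {suc j} (ℕ.s≤s i≤j) =
  *-monoˡ-≤-nonNeg r {{nonNegative r≥0}} (pow-antimonoʳ-≤ r≥0 r≤1 i≤j)

pow-inverse : ∀ {r x} → r * x ≡ 1ℚ → ∀ j → pow r j * pow x j ≡ 1ℚ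
pow-inverse rx≡1 ℕ.zero = refl
pow-inverse {r} {x} rx≡1 (suc j) =
  trans (interchange r (pow r j) x (pow x j)) (cong₂ _*_ rx≡1 (pow-inverse rx≡1 j))

≤recip⇒≤inverse : ∀ {c R X} (c>0 : 0ℚ < c) → 0ℚ ≤ R → R * X ≡ 1ℚ → X ≤ recip c c>0 → c ≤ R
≤recip⇒≤inverse {c} {R} {X} c>0 R≥0 RX≡1 X≤1/c = begin
  c             ≡⟨ sym (*-identityʳ c) ⟩
  c * 1ℚ        ≡⟨ cong (c *_) (sym RX≡1) ⟩
  c * (R * X)   ≡⟨ x∙yz≈y∙xz c R X ⟩
  R * (c * X)   ≤⟨ *-monoˡ-≤-nonNeg R {{nonNegative R≥0}} cX≤1 ⟩
  R * 1ℚ        ≡⟨ *-identityʳ R ⟩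
  R             ∎
  where
  open ≤-Reasoning
  cX≤1 : c * X ≤ 1ℚ
  cX≤1 = subst (c * X ≤_) (*-inverseʳ c {{pos⇒nonZero c {{positive c>0}}}})
           (*-monoˡ-≤-nonNeg c {{nonNegative (<⇒≤ c>0)}} X≤1/c)

module _ {ε : ℚ} (ε>0 : 0ℚ < ε) where

  private
    1+ε>0 : 0ℚ < 1ℚ + ε
    1+ε>0 = +-mono-< 0<1 ε>0

    -- negPow ε ε>0 j reduces to pow ρ j: recip's positivity proof only feeds an irrelevant instance.
    ρ : ℚ
    ρ = recip (1ℚ + ε) 1+ε>0

    ρ*[1+ε]≡1 : ρ * (1ℚ + ε) ≡ 1ℚ
    ρ*[1+ε]≡1 = *-inverseˡ (1ℚ + ε) {{pos⇒nonZero (1ℚ + ε) {{positive 1+ε>0}}}}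

    ρ≥0 : 0ℚ ≤ ρ
    ρ≥0 = <⇒≤ (positive⁻¹ ρ {{1/pos⇒pos (1ℚ + ε) {{positive 1+ε>0}}}})

    ρ≤1 : ρ ≤ 1ℚ
    ρ≤1 = begin
      ρ              ≡⟨ sym (*-identityʳ ρ) ⟩
      ρ * 1ℚ         ≤⟨ *-monoˡ-≤-nonNeg ρ {{nonNegative ρ≥0}} 1≤1+ε ⟩
      ρ * (1ℚ + ε)   ≡⟨ ρ*[1+ε]≡1 ⟩
      1ℚ             ∎
      where
      open ≤-Reasoning
      1≤1+ε : 1ℚ ≤ 1ℚ + ε
      1≤1+ε = subst (_≤ 1ℚ + ε) (+-identityʳ 1ℚ) (+-mono-≤ ≤-refl (<⇒≤ ε>0))

  negPow-nonNeg : ∀ j → 0ℚ ≤ negPow ε ε>0 j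
  negPow-nonNeg = pow-nonNeg ρ≥0

  negPow-antimono-≤ : ∀ {i j} → i ℕ.≤ j → negPow ε ε>0 j ≤ negPow ε ε>0 i
  negPow-antimono-≤ = pow-antimonoʳ-≤ ρ≥0 ρ≤1

  ≤recip⇒≤negPow : ∀ {c} (c>0 : 0ℚ < c) {b} → pow (1ℚ + ε) b ≤ recip c c>0 → c ≤ negPow ε ε>0 b
  ≤recip⇒≤negPow c>0 {b} = ≤recip⇒≤inverse c>0 (negPow-nonNeg b) (pow-inverse ρ*[1+ε]≡1 b)

module _ {m k : ℕ} (S : Fin k → Subset m) (l : Fin k → ℕ) where

  level≤elemLevel : ∀ {s e} → memb S s e ≡ true → l s ℕ.≤ elemLevel S l e
  level≤elemLevel {s} {e} e∈s =
    ∈⇒≤maxL (map l (filter member? (allFin k))) (∈-map⁺ l (∈-filter⁺ member? (∈-allFin s) e∈s))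
    where member? = λ s′ → memb S s′ e Bool.≟ true

  otherLevel≤elemLevel : ∀ s e → otherLevel S l s e ℕ.≤ elemLevel S l e
  otherLevel≤elemLevel s e = maxL-lub (map l (filter other? (allFin k))) λ y∈ →
    let (s′ , s′∈ , y≡ls′) = ∈-map⁻ l y∈
        (_ , _ , e∈s′)     = ∈-filter⁻ other? {xs = allFin k} s′∈
    in subst (ℕ._≤ elemLevel S l e) (sym y≡ls′) (level≤elemLevel e∈s′)
    where other? = λ s′ → ¬? (s′ Fin.≟ s) ×-dec (memb S s′ e Bool.≟ true)

  negPow≤wLevel : ∀ {ε} (ε>0 : 0ℚ < ε) {s e} i → memb S s e ≡ true →
                  negPow ε ε>0 (i ℕ.⊔ otherLevel S l s e) ≤ wLevel ε ε>0 S l s i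
  negPow≤wLevel {ε} ε>0 {s} {e} i e∈s =
    subst (_≤ wLevel ε ε>0 S l s i) summand-e (∈⇒≤sumℚ summand summand-nonNeg (allFin m) (∈-allFin e))
    where
    summand : Fin m → ℚ
    summand e′ = if memb S s e′ then negPow ε ε>0 (i ℕ.⊔ otherLevel S l s e′) else 0ℚ

    summand-nonNeg : ∀ e′ → 0ℚ ≤ summand e′
    summand-nonNeg e′ with memb S s e′
    ... | true  = negPow-nonNeg ε>0 (i ℕ.⊔ otherLevel S l s e′)
    ... | false = ≤-refl

    summand-e : summand e ≡ negPow ε ε>0 (i ℕ.⊔ otherLevel S l s e)
    summand-e rewrite e∈s = refl

  elemLevel<⇒≤wLevel : ∀ {ε} (ε>0 : 0ℚ < ε) {s e b} → memb S s e ≡ true → elemLevel S l e ℕ.< b →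
                       negPow ε ε>0 b ≤ wLevel ε ε>0 S l s (suc (l s))
  elemLevel<⇒≤wLevel {ε} ε>0 {s} {e} {b} e∈s le<b = ≤-trans {negPow ε ε>0 b}
    (negPow-antimono-≤ ε>0 (ℕ.⊔-lub (ℕ.≤-trans (ℕ.s≤s (level≤elemLevel e∈s)) le<b)
                                     (ℕ.≤-trans (otherLevel≤elemLevel s e) (ℕ.<⇒≤ le<b))))
    (negPow≤wLevel ε>0 (suc (l s)) e∈s)

lemmaB6 : (n m k : ℕ) → m ℕ.≤ n → (S : Fin k → Subset m)
    → (C : ℚ) → (hC : 1ℚ < C)
    → (c : Fin k → ℚ) → (hc0 : ∀ s → 0ℚ < c s)
    → (∀ s → recip C (Data.Rational.Properties.<-trans 0<1 hC) < c s × c s < 1ℚ)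
    → (ε : ℚ) → (hε : 0ℚ < ε) → ε < (ℤ.+ 1) / 10
    → (t : ℕ) → IsCeilLog ε (C * ((ℤ.+ n) / 1)) t
    → (l : Fin k → ℕ) → (∀ s → l s ℕ.≤ t ℕ.+ 1)
    → (∀ s → wLevel ε hε S l s (suc (l s)) < c s)
    → ∀ s → (b : ℕ) → IsFloorLog ε (recip (c s) (hc0 s)) b
    → ∀ (i : ℤ) → i ℤ.< + b
    → ∀ e → e ∈ S s → + (elemLevel S l e) ≢ i
lemmaB6 _ _ _ _ S _ _ c c>0 _ ε ε>0 _ _ _ l _ w<c s b (base≤1/c , _) (+ _) (ℤ.+<+ le<b) e e∈s refl =
  <-irrefl refl (≤-<-trans c≤w (w<c s))
  where
  c≤w : c s ≤ wLevel ε ε>0 S l s (suc (l s))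
  c≤w = ≤-trans (≤recip⇒≤negPow ε>0 (c>0 s) {b} base≤1/c)
                (elemLevel<⇒≤wLevel S l ε>0 {b = b} ([]=⇒lookup e∈s) le<b)
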